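{- Let $i_1,\dots,i_m,k\in[n]$ be distinct and $j_1,\dots,j_m,l\in[n]$ be distinct. Let $\sigma\in S_n$ be such that exactly $q$ indices $r\in[m]$ satisfy $P_\sigma(i_r,j_r)=1$. Then the slack of the inequality $$\sum_{r=1}^{m}Y_{i_rj_r,kl}-Y_{kl,kl}-\sum_{1\leqslant r<s\leqslant m}Y_{i_rj_r,i_sj_s}\leqslant 0$$ with respect to $P^{[2]}_\sigma$ equals $\binom{q-P_\sigma(k,l)}{2}$.
   Context: $P_\sigma$ is the $n\times n$ permutation matrix of $\sigma\in S_n$ ($P_\sigma(i,j)=1$ iff $\sigma(i)=j$); $n^2\times n^2$ matrices have rows/columns indexed by pairs $(ij)$, $Y_{ij,kl}$ being the entry in row $(ij)$, column $(kl)$; $P^{[2]}_\sigma(ij,kl)=P_\sigma(i,j)P_\sigma(k,l)$. The slack of an inequality $\langle A,Y\rangle\leqslant b$ at a point $Y$ is $b-\langle A,Y\rangle$. Here $\binom{x}{2}=x(x-1)/2$ for any integer $x$. -}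

module Defs where

open import Data.Nat using (ℕ; zero; suc)
open import Data.Fin using (Fin; zero; suc; _<?_; _≟_)
open import Data.Fin.Permutation using (Permutation′; _⟨$⟩ʳ_) public
open import Data.Integer using (ℤ; +_; _+_; _-_; _*_)
open import Data.Integer.DivMod using (_/_)
open import Data.Product using (_×_; _,_)
open import Relation.Nullary using (does)
open import Data.Bool using (if_then_else_)

∑ : (m : ℕ) → (Fin m → ℤ) → ℤ
∑ zero    f = + 0
∑ (suc m) f = f zero + ∑ m (λ r → f (suc r))

count : (m : ℕ) → (Fin m → Data.Bool.Bool) → ℕ
count zero    p = zero
count (suc m) p = if p zero then suc (count m (λ r → p (suc r))) else count m (λ r → p (suc r))

P : {n : ℕ} → Permutation′ n → Fin n → Fin n → ℤ
P σ i j = if does ((σ ⟨$⟩ʳ i) ≟ j) then + 1 else + 0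

-- n²×n² matrices indexed by pairs: Y (i , j) (k , l) = Y_{ij,kl}
Mat2 : ℕ → Set
Mat2 n = Fin n × Fin n → Fin n × Fin n → ℤ

P2 : {n : ℕ} → Permutation′ n → Mat2 n
P2 σ (i , j) (k , l) = P σ i j * P σ k l

ineqLHS : {n : ℕ} (m : ℕ) (is js : Fin m → Fin n) (k l : Fin n) → Mat2 n → ℤ
ineqLHS m is js k l Y =
  (∑ m (λ r → Y (is r , js r) (k , l)) - Y (k , l) (k , l))
  - ∑ m (λ r → ∑ m (λ s → if does (r <? s) then Y (is r , js r) (is s , js s) else + 0))

slack : {n : ℕ} (m : ℕ) (is js : Fin m → Fin n) (k l : Fin n) → Mat2 n → ℤ
slack m is js k l Y = + 0 - ineqLHS m is js k l Y

-- binom(x,2) = x(x-1)/2 for any integer x (x(x-1) is always even)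
binom2 : ℤ → ℤ
binom2 x = (x * (x - + 1)) / + 2

-- P^{[2]}_σ is the rank-one matrix x xᵀ of the 0/1 vector x = (P_σ(i,j)), so with x_r = P_σ(i_r,j_r)
-- and p = P_σ(k,l) the slack is  ∑_{r<s} x_r x_s − p ∑_r x_r + p² = C(q,2) − pq + p.  The pair sum
-- of a 0/1 vector with q ones is C(q,2), and since p² = p this equals C(q − p, 2).
module Submission where

open import Defs
open import Data.Nat using (ℕ)
open import Data.Fin using (Fin)
open import Data.Integer using (+_; _-_)
open import Data.Bool using (Bool)
open import Relation.Nullary using (¬_; does)
open import Relation.Binary.PropositionalEquality using (_≡_)
open import Function.Definitions using (Injective)
open import Data.Fin using (_≟_)

open import Data.Nat as ℕ using (zero; suc; s≤s)
open import Data.Fin using (zero; suc; _<?_)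
open import Data.Bool using (true; false; if_then_else_)
open import Data.Integer using (ℤ; _+_; _*_; -[1+_]; +[1+_])
open import Data.Integer.Properties using (+-identityˡ; *-zeroʳ; *-distribˡ-+; *-distribʳ-+)
open import Data.Integer.DivMod using (_/_; a≡a%n+[a/n]*n; n%d<d)
open import Data.Integer.Tactic.RingSolver using (solve-∀)
open import Relation.Binary.PropositionalEquality using (refl; sym; trans; cong; cong₂; module ≡-Reasoning)

indicator : Bool → ℤ
indicator b = if b then + 1 else + 0

indicator-idem : ∀ b → indicator b * indicator b ≡ indicator b
indicator-idem true  = refl
indicator-idem false = refl

∑-cong : ∀ m {f g : Fin m → ℤ} → (∀ r → f r ≡ g r) → ∑ m f ≡ ∑ m g
∑-cong zero    f≗g = refl
∑-cong (suc m) f≗g = cong₂ _+_ (f≗g zero) (∑-cong m (λ r → f≗g (suc r)))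

∑-*ˡ : ∀ m c (f : Fin m → ℤ) → c * ∑ m f ≡ ∑ m (λ r → c * f r)
∑-*ˡ zero    c f = *-zeroʳ c
∑-*ˡ (suc m) c f = trans (*-distribˡ-+ c (f zero) _) (cong (_+_ (c * f zero)) (∑-*ˡ m c (λ r → f (suc r))))

∑-*ʳ : ∀ m c (f : Fin m → ℤ) → ∑ m (λ r → f r * c) ≡ ∑ m f * c
∑-*ʳ zero    c f = refl
∑-*ʳ (suc m) c f = trans (cong (_+_ (f zero * c)) (∑-*ʳ m c (λ r → f (suc r)))) (sym (*-distribʳ-+ c (f zero) _))

∑-indicator : ∀ m (b : Fin m → Bool) → ∑ m (λ r → indicator (b r)) ≡ + count m b
∑-indicator zero    b = refl
∑-indicator (suc m) b with b zero
... | true  = cong (_+_ (+ 1)) (∑-indicator m (λ r → b (suc r)))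
... | false = trans (+-identityˡ _) (∑-indicator m (λ r → b (suc r)))

count-suc : ∀ m (b : Fin (suc m) → Bool) → + count (suc m) b ≡ indicator (b zero) + + count m (λ r → b (suc r))
count-suc m b with b zero
... | true  = refl
... | false = sym (+-identityˡ _)

pairProducts : ∀ m → (Fin m → ℤ) → ℤ
pairProducts m x = ∑ m (λ r → ∑ m (λ s → if does (r <? s) then x r * x s else + 0))

pairProducts-suc : ∀ m (x : Fin (suc m) → ℤ) →
  pairProducts (suc m) x ≡ x zero * ∑ m (λ s → x (suc s)) + pairProducts m (λ r → x (suc r))
pairProducts-suc m x = cong₂ _+_
  (trans (+-identityˡ _) (sym (∑-*ˡ m (x zero) (λ s → x (suc s)))))
  (∑-cong m (λ r → +-identityˡ _))

pairProducts-indicator : ∀ m (b : Fin m → Bool) → let c = + count m b in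
  pairProducts m (λ r → indicator (b r)) * + 2 ≡ c * (c - + 1)
pairProducts-indicator zero    b = refl
pairProducts-indicator (suc m) b = begin
  pairProducts (suc m) x * + 2
    ≡⟨ cong (_* + 2) (pairProducts-suc m x) ⟩
  (x zero * ∑ m x′ + pairProducts m x′) * + 2
    ≡⟨ *-distribʳ-+ (+ 2) (x zero * ∑ m x′) _ ⟩
  x zero * ∑ m x′ * + 2 + pairProducts m x′ * + 2
    ≡⟨ cong₂ (λ u v → x zero * u * + 2 + v) (∑-indicator m b′) (pairProducts-indicator m b′) ⟩
  indicator (b zero) * + count m b′ * + 2 + + count m b′ * (+ count m b′ - + 1)
    ≡⟨ step (b zero) (+ count m b′) ⟩
  (indicator (b zero) + + count m b′) * ((indicator (b zero) + + count m b′) - + 1)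
    ≡⟨ cong (λ c → c * (c - + 1)) (sym (count-suc m b)) ⟩
  + count (suc m) b * (+ count (suc m) b - + 1) ∎
  where
  open ≡-Reasoning
  b′ : Fin m → Bool
  b′ r = b (suc r)
  x : Fin (suc m) → ℤ
  x r = indicator (b r)
  x′ : Fin m → ℤ
  x′ r = x (suc r)
  step : ∀ t c → indicator t * c * + 2 + c * (c - + 1)
                 ≡ (indicator t + c) * ((indicator t + c) - + 1)
  step true  = solve-∀
  step false = solve-∀

even-remainder : ∀ z r → r ℕ.< 2 → z * + 2 ≡ + r → z ≡ + 0
even-remainder (+ 0)     _ _ _ = refl
even-remainder +[1+ n ]  .(suc (suc (n ℕ.* 2))) (s≤s (s≤s ())) refl
even-remainder -[1+ n ]  _ _ ()

*2/2 : ∀ a → (a * + 2) / + 2 ≡ a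
*2/2 a = begin
  q             ≡⟨ +-identityˡ q ⟨
  + 0 + q       ≡⟨ cong (_+ q) a-q≡0 ⟨
  (a - q) + q   ≡⟨ a-q+q a q ⟩
  a             ∎
  where
  open ≡-Reasoning
  q : ℤ
  q = (a * + 2) / + 2
  a-q+q : ∀ a q → (a - q) + q ≡ a
  a-q+q = solve-∀
  rearrange : ∀ a q r → a * + 2 ≡ r + q * + 2 → (a - q) * + 2 ≡ r
  rearrange a q r eq = trans (distrib a q) (trans (cong (_- q * + 2) eq) (cancel r q))
    where
    distrib : ∀ a q → (a - q) * + 2 ≡ a * + 2 - q * + 2
    distrib = solve-∀
    cancel : ∀ r q → r + q * + 2 - q * + 2 ≡ r
    cancel = solve-∀
  a-q≡0 : a - q ≡ + 0
  a-q≡0 = even-remainder (a - q) _ (n%d<d (a * + 2) (+ 2))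
            (rearrange a q _ (a≡a%n+[a/n]*n (a * + 2) (+ 2)))

binom2-unique : ∀ a x → a * + 2 ≡ x * (x - + 1) → binom2 x ≡ a
binom2-unique a x eq = trans (cong (_/ + 2) (sym eq)) (*2/2 a)

slack-closed-form : ∀ c p D → p * p ≡ p → D * + 2 ≡ c * (c - + 1) →
  + 0 - ((c * p - p * p) - D) ≡ binom2 (c - p)
slack-closed-form c p D p²≡p 2D≡c[c-1] = sym (binom2-unique _ (c - p) (begin
  (+ 0 - ((c * p - p * p) - D)) * + 2   ≡⟨ expand c p D ⟩
  D * + 2 - + 2 * c * p + + 2 * (p * p)  ≡⟨ cong₂ (λ u v → u - + 2 * c * p + + 2 * v) 2D≡c[c-1] p²≡p ⟩
  c * (c - + 1) - + 2 * c * p + + 2 * p  ≡⟨ regroup c p ⟩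
  (c - p) * ((c - p) - + 1) + (p - p * p) ≡⟨ cong (λ v → (c - p) * ((c - p) - + 1) + (p - v)) p²≡p ⟩
  (c - p) * ((c - p) - + 1) + (p - p)    ≡⟨ cancel (c - p) p ⟩
  (c - p) * ((c - p) - + 1)              ∎))
  where
  open ≡-Reasoning
  expand : ∀ c p D → (+ 0 - ((c * p - p * p) - D)) * + 2 ≡ D * + 2 - + 2 * c * p + + 2 * (p * p)
  expand = solve-∀
  regroup : ∀ c p → c * (c - + 1) - + 2 * c * p + + 2 * p ≡ (c - p) * ((c - p) - + 1) + (p - p * p)
  regroup = solve-∀
  cancel : ∀ y p → y * (y - + 1) + (p - p) ≡ y * (y - + 1)
  cancel = solve-∀

lemma11 : (n m : ℕ) (is js : Fin m → Fin n) (k l : Fin n) (σ : Permutation′ n) (q : ℕ)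
    → Injective _≡_ _≡_ is → (∀ r → ¬ (is r ≡ k))
    → Injective _≡_ _≡_ js → (∀ r → ¬ (js r ≡ l))
    → count m (λ r → does ((σ ⟨$⟩ʳ is r) ≟ js r)) ≡ q
    → slack m is js k l (P2 σ) ≡ binom2 (+ q - P σ k l)
lemma11 n m is js k l σ q _ _ _ _ refl = begin
  slack m is js k l (P2 σ)
    ≡⟨ cong (λ u → + 0 - ((u - p * p) - pairProducts m x)) (∑-*ʳ m p x) ⟩
  + 0 - ((∑ m x * p - p * p) - pairProducts m x)
    ≡⟨ cong (λ c → + 0 - ((c * p - p * p) - pairProducts m x)) (∑-indicator m b) ⟩
  + 0 - ((+ q * p - p * p) - pairProducts m x)
    ≡⟨ slack-closed-form (+ q) p _ (indicator-idem (does ((σ ⟨$⟩ʳ k) ≟ l))) (pairProducts-indicator m b) ⟩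
  binom2 (+ q - p) ∎
  where
  open ≡-Reasoning
  b : Fin m → Bool
  b r = does ((σ ⟨$⟩ʳ is r) ≟ js r)
  x : Fin m → ℤ
  x r = indicator (b r)
  p : ℤ
  p = P σ k l
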